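{- Let $a,b,k,d\in\mathbb{N}$ with $a,b>1$, $\gcd(a,b)=1$, and $d\mid a$. Let $g_i=a^{k-i}b^i$ for $0\le i\le k$ and \[f_1(x)=\sum_{n_1=0}^{a-1}\sum_{n_2=0}^{a-1}\cdots\sum_{n_k=0}^{a-1}(n_1g_1+\cdots+n_kg_k)\,x^{n_1g_1+\cdots+n_kg_k}.\] Then $f_1(x)\equiv\sum_{i=0}^{d-1}c_{1,i}x^i\pmod{(x^d-1)}$ for some integers $c_{1,0},\dots,c_{1,d-1}$, and \[c_{1,0}=a^k\cdot\frac{b^k(ab-a+ad-bd)-a^k(a-1)b}{2(b-a)d}.\] -}

module Defs where

open import Data.Nat using (ℕ; zero; suc; _+_; _*_; _∸_; _^_; _%_; NonZero)
open import Data.Nat.Properties using (_≟_)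
open import Data.List using (List; []; _∷_; map; concatMap; upTo)
open import Data.Integer as ℤ using (ℤ; +_)
open import Data.Product using (_×_; _,_)
open import Relation.Nullary using (yes; no)

tuples : ℕ → ℕ → List (List ℕ)
tuples a zero = [] ∷ []
tuples a (suc k) = concatMap (λ n → map (n ∷_) (tuples a k)) (upTo a)

g : ℕ → ℕ → ℕ → ℕ → ℕ
g a b k i = a ^ (k ∸ i) * b ^ i

weighted : ℕ → ℕ → ℕ → ℕ → List ℕ → ℕ
weighted a b k i [] = 0
weighted a b k i (n ∷ ns) = n * g a b k i + weighted a b k (suc i) ns

expo : ℕ → ℕ → ℕ → List ℕ → ℕ
expo a b k ns = weighted a b k 1 ns

-- a polynomial as a finite formal sum of monomials c · x^e (pairs (c , e))
Poly : Set
Poly = List (ℤ × ℕ)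

f₁ : ℕ → ℕ → ℕ → Poly
f₁ a b k = map (λ ns → (+ expo a b k ns , expo a b k ns)) (tuples a k)

-- coefficient of x^i in the canonical reduction of p modulo (x^d - 1),
-- i.e. the representative Σ_{i<d} c_i x^i obtained from x^e ↦ x^(e mod d)
coeffMod : (d : ℕ) .{{_ : NonZero d}} → ℕ → Poly → ℤ
coeffMod d i [] = + 0
coeffMod d i ((c , e) ∷ p) with e % d ≟ i
... | yes _ = c ℤ.+ coeffMod d i p
... | no _ = coeffMod d i p

-- Every g_i with i < k is a multiple of a, hence of d, while g_k = b^k is prime to d. So the exponent
-- n₁g₁ + ⋯ + n_kg_k is divisible by d exactly when n_k is, i.e. n_k = j d with j < q = a/d. Summing the
-- exponent over these tuples gives q · Σ_{n₁,…,n_{k−1}} (n₁g₁ + ⋯ + n_{k−1}g_{k−1}) + a^{k−1} d b^k Σ_{j<q} j,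
-- the first sum equals a^{k−1}(a − 1)/2 · (g₁ + ⋯ + g_{k−1}), and (b − a)(g₁ + ⋯ + g_{k−1}) = a b^k − a^k b.

module Submission where

open import Defs
open import Data.Nat using (ℕ; _<_; _≤_; _^_; NonZero)
open import Data.Nat.GCD using (gcd)
open import Data.Nat.Divisibility using (_∣_)
open import Data.Integer as ℤ using (ℤ; +_)
open import Relation.Binary.PropositionalEquality using (_≡_)

open import Data.Nat using (zero; suc; _+_; _*_; _∸_; _%_; s≤s; z≤n; ≢-nonZero⁻¹)
import Data.Nat.Properties as ℕP
open import Data.Nat.Properties using (_≟_)
open import Data.Nat.Divisibility using (_∣?_; _∣0; ∣-refl; ∣-trans; ∣1⇒≡1; ∣⇒≤; ∣m⇒∣m*n; ∣n⇒∣m*n; ∣m∣n⇒∣m+n; ∣m+n∣m⇒∣n; m%n≡0⇒n∣m; n∣m⇒m%n≡0; divides)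
open import Data.Nat.Coprimality using (Coprime; coprime-divisor; gcd≡1⇒coprime)
import Data.Integer.Properties as ℤP
open import Data.Integer.Tactic.RingSolver using (solve)
open import Algebra.Properties.CommutativeSemigroup ℤP.+-commutativeSemigroup using (interchange)
open import Algebra.Properties.CommutativeSemigroup ℕP.*-commutativeSemigroup using () renaming (x∙yz≈y∙xz to *-leftComm)
open import Data.Bool using (if_then_else_)
open import Data.List using (List; []; _∷_; _∷ʳ_; _++_; map; concat; concatMap; length; upTo)
open import Data.List.Properties using (length-++; length-map; length-upTo; map-upTo; upTo-∷ʳ)
open import Data.Product using (_,_; uncurry)
open import Function using (_∘_)
open import Relation.Nullary using (¬_; yes; no; does; contradiction)
open import Relation.Nullary.Decidable using (dec-true; dec-false)
open import Relation.Binary.PropositionalEquality using (refl; sym; trans; cong; cong₂; subst; module ≡-Reasoning)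
open ≡-Reasoning

private variable
  U V : Set

∑ : List U → (U → ℤ) → ℤ
∑ []       f = + 0
∑ (x ∷ xs) f = f x ℤ.+ ∑ xs f

syntax ∑ xs (λ x → e) = ∑[ x ∈ xs ] e

∑-cong : (xs : List U) {f g : U → ℤ} → (∀ x → f x ≡ g x) → ∑ xs f ≡ ∑ xs g
∑-cong []       f≡g = refl
∑-cong (x ∷ xs) f≡g = cong₂ ℤ._+_ (f≡g x) (∑-cong xs f≡g)

∑-++ : (xs ys : List U) (f : U → ℤ) → ∑ (xs ++ ys) f ≡ ∑ xs f ℤ.+ ∑ ys f
∑-++ []       ys f = sym (ℤP.+-identityˡ (∑ ys f))
∑-++ (x ∷ xs) ys f = trans (cong (ℤ._+_ (f x)) (∑-++ xs ys f)) (sym (ℤP.+-assoc (f x) (∑ xs f) (∑ ys f)))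

∑-map : (h : U → V) (xs : List U) (f : V → ℤ) → ∑ (map h xs) f ≡ ∑ xs (f ∘ h)
∑-map h []       f = refl
∑-map h (x ∷ xs) f = cong (ℤ._+_ (f (h x))) (∑-map h xs f)

∑-concat : (xss : List (List U)) (f : U → ℤ) → ∑ (concat xss) f ≡ ∑[ xs ∈ xss ] ∑ xs f
∑-concat []         f = refl
∑-concat (xs ∷ xss) f = trans (∑-++ xs (concat xss) f) (cong (ℤ._+_ (∑ xs f)) (∑-concat xss f))

∑-concatMap : (h : U → List V) (xs : List U) (f : V → ℤ) → ∑ (concatMap h xs) f ≡ ∑[ x ∈ xs ] ∑ (h x) f
∑-concatMap h xs f = trans (∑-concat (map h xs) f) (∑-map h xs (λ ys → ∑ ys f))

∑-+ : (xs : List U) (f g : U → ℤ) → ∑[ x ∈ xs ] (f x ℤ.+ g x) ≡ ∑ xs f ℤ.+ ∑ xs g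
∑-+ []       f g = refl
∑-+ (x ∷ xs) f g = trans (cong (ℤ._+_ (f x ℤ.+ g x)) (∑-+ xs f g)) (interchange (f x) (g x) (∑ xs f) (∑ xs g))

∑-*ˡ : (xs : List U) (c : ℤ) (f : U → ℤ) → ∑[ x ∈ xs ] (c ℤ.* f x) ≡ c ℤ.* ∑ xs f
∑-*ˡ []       c f = sym (ℤP.*-zeroʳ c)
∑-*ˡ (x ∷ xs) c f = trans (cong (ℤ._+_ (c ℤ.* f x)) (∑-*ˡ xs c f)) (sym (ℤP.*-distribˡ-+ c (f x) (∑ xs f)))

∑-const : (xs : List U) (c : ℤ) → ∑[ _ ∈ xs ] c ≡ + length xs ℤ.* c
∑-const []       c = refl
∑-const (x ∷ xs) c = trans (cong (ℤ._+_ c) (∑-const xs c)) (sym (ℤP.suc-* (+ length xs) c))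

∑-*ʳ : (xs : List U) (f : U → ℤ) (c : ℤ) → ∑[ x ∈ xs ] (f x ℤ.* c) ≡ ∑ xs f ℤ.* c
∑-*ʳ xs f c = begin
  ∑[ x ∈ xs ] (f x ℤ.* c) ≡⟨ ∑-cong xs (λ x → ℤP.*-comm (f x) c) ⟩
  ∑[ x ∈ xs ] (c ℤ.* f x) ≡⟨ ∑-*ˡ xs c f ⟩
  c ℤ.* ∑ xs f            ≡⟨ ℤP.*-comm c (∑ xs f) ⟩
  ∑ xs f ℤ.* c            ∎

∑-separable : (xs : List U) (ys : List V) (f : U → ℤ) (g : V → ℤ) →
  ∑[ x ∈ xs ] ∑[ y ∈ ys ] (f x ℤ.+ g y) ≡ + length ys ℤ.* ∑ xs f ℤ.+ + length xs ℤ.* ∑ ys g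
∑-separable xs ys f g = begin
  ∑[ x ∈ xs ] ∑[ y ∈ ys ] (f x ℤ.+ g y)
    ≡⟨ ∑-cong xs row ⟩
  ∑[ x ∈ xs ] (+ length ys ℤ.* f x ℤ.+ ∑ ys g)
    ≡⟨ ∑-+ xs _ _ ⟩
  ∑[ x ∈ xs ] (+ length ys ℤ.* f x) ℤ.+ ∑[ _ ∈ xs ] ∑ ys g
    ≡⟨ cong₂ ℤ._+_ (∑-*ˡ xs (+ length ys) f) (∑-const xs (∑ ys g)) ⟩
  + length ys ℤ.* ∑ xs f ℤ.+ + length xs ℤ.* ∑ ys g ∎
  where
  row : ∀ x → ∑[ y ∈ ys ] (f x ℤ.+ g y) ≡ + length ys ℤ.* f x ℤ.+ ∑ ys g
  row x = trans (∑-+ ys (λ _ → f x) g) (cong (λ s → s ℤ.+ ∑ ys g) (∑-const ys (f x)))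

∑-upTo-suc : (n : ℕ) (f : ℕ → ℤ) → ∑ (upTo (suc n)) f ≡ f 0 ℤ.+ ∑[ i ∈ upTo n ] f (suc i)
∑-upTo-suc n f = cong (ℤ._+_ (f 0)) (trans (cong (λ xs → ∑ xs f) (sym (map-upTo suc n))) (∑-map suc (upTo n) f))

∑-upTo-sucʳ : (n : ℕ) (f : ℕ → ℤ) → ∑ (upTo (suc n)) f ≡ ∑ (upTo n) f ℤ.+ f n
∑-upTo-sucʳ n f = begin
  ∑ (upTo (suc n)) f              ≡⟨ cong (λ xs → ∑ xs f) (upTo-∷ʳ n) ⟨
  ∑ (upTo n ∷ʳ n) f               ≡⟨ ∑-++ (upTo n) (n ∷ []) f ⟩
  ∑ (upTo n) f ℤ.+ (f n ℤ.+ + 0)  ≡⟨ cong (ℤ._+_ (∑ (upTo n) f)) (ℤP.+-identityʳ (f n)) ⟩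
  ∑ (upTo n) f ℤ.+ f n            ∎

∑-upTo-+ : (m n : ℕ) (f : ℕ → ℤ) → ∑ (upTo (m + n)) f ≡ ∑ (upTo m) f ℤ.+ ∑[ i ∈ upTo n ] f (m + i)
∑-upTo-+ zero    n f = sym (ℤP.+-identityˡ (∑ (upTo n) f))
∑-upTo-+ (suc m) n f = begin
  ∑ (upTo (suc m + n)) f
    ≡⟨ ∑-upTo-suc (m + n) f ⟩
  f 0 ℤ.+ ∑[ i ∈ upTo (m + n) ] f (suc i)
    ≡⟨ cong (ℤ._+_ (f 0)) (∑-upTo-+ m n (f ∘ suc)) ⟩
  f 0 ℤ.+ (∑[ i ∈ upTo m ] f (suc i) ℤ.+ ∑[ i ∈ upTo n ] f (suc m + i))
    ≡⟨ ℤP.+-assoc (f 0) _ _ ⟨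
  f 0 ℤ.+ ∑[ i ∈ upTo m ] f (suc i) ℤ.+ ∑[ i ∈ upTo n ] f (suc m + i)
    ≡⟨ cong (λ s → s ℤ.+ ∑[ i ∈ upTo n ] f (suc m + i)) (∑-upTo-suc m f) ⟨
  ∑ (upTo (suc m)) f ℤ.+ ∑[ i ∈ upTo n ] f (suc m + i) ∎

∑-upTo-cong : (n : ℕ) {f g : ℕ → ℤ} → (∀ {i} → i < n → f i ≡ g i) → ∑ (upTo n) f ≡ ∑ (upTo n) g
∑-upTo-cong zero    f≡g = refl
∑-upTo-cong (suc n) {f} {g} f≡g = begin
  ∑ (upTo (suc n)) f                    ≡⟨ ∑-upTo-suc n f ⟩
  f 0 ℤ.+ ∑[ i ∈ upTo n ] f (suc i)     ≡⟨ cong₂ ℤ._+_ (f≡g (s≤s z≤n)) (∑-upTo-cong n (f≡g ∘ s≤s)) ⟩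
  g 0 ℤ.+ ∑[ i ∈ upTo n ] g (suc i)     ≡⟨ ∑-upTo-suc n g ⟨
  ∑ (upTo (suc n)) g                    ∎

gauss : (n : ℕ) → + 2 ℤ.* ∑[ i ∈ upTo n ] (+ i) ≡ + n ℤ.* (+ n ℤ.- + 1)
gauss zero    = refl
gauss (suc n) = trans (cong (+ 2 ℤ.*_) (∑-upTo-sucʳ n (λ i → + i))) (step (+ n) _ (gauss n))
  where
  step : ∀ N S → + 2 ℤ.* S ≡ N ℤ.* (N ℤ.- + 1) → + 2 ℤ.* (S ℤ.+ N) ≡ (+ 1 ℤ.+ N) ℤ.* ((+ 1 ℤ.+ N) ℤ.- + 1)
  step N S 2S≡ = begin
    + 2 ℤ.* (S ℤ.+ N)                      ≡⟨ solve (S ∷ N ∷ []) ⟩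
    + 2 ℤ.* S ℤ.+ + 2 ℤ.* N                ≡⟨ cong (λ t → t ℤ.+ + 2 ℤ.* N) 2S≡ ⟩
    N ℤ.* (N ℤ.- + 1) ℤ.+ + 2 ℤ.* N        ≡⟨ solve (N ∷ []) ⟩
    (+ 1 ℤ.+ N) ℤ.* ((+ 1 ℤ.+ N) ℤ.- + 1)  ∎

-- The summand is g_{j+1} for k = m + 1.
geometric-sum : (a b m : ℕ) →
  (+ b ℤ.- + a) ℤ.* ∑[ j ∈ upTo m ] (+ (a ^ (m ∸ j) * b ^ suc j)) ≡ + a ℤ.* + (b ^ suc m) ℤ.- + (a ^ suc m) ℤ.* + b
geometric-sum a b zero    = begin
  (+ b ℤ.- + a) ℤ.* + 0                         ≡⟨ ℤP.*-zeroʳ (+ b ℤ.- + a) ⟩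
  + 0                                           ≡⟨ ℤP.+-inverseʳ (+ a ℤ.* + b) ⟨
  + a ℤ.* + b ℤ.- + a ℤ.* + b                   ≡⟨ cong₂ (λ u v → + a ℤ.* + u ℤ.- + v ℤ.* + b) (ℕP.^-identityʳ b) (ℕP.^-identityʳ a) ⟨
  + a ℤ.* + (b ^ 1) ℤ.- + (a ^ 1) ℤ.* + b       ∎
geometric-sum a b (suc m) = begin
  (B ℤ.- A) ℤ.* ∑[ j ∈ upTo (suc m) ] (+ (a ^ (suc m ∸ j) * b ^ suc j))
    ≡⟨ cong (λ t → (B ℤ.- A) ℤ.* t) (trans (∑-upTo-suc m (λ j → + (a ^ (suc m ∸ j) * b ^ suc j))) (cong₂ ℤ._+_ first rest)) ⟩
  (B ℤ.- A) ℤ.* (Aᵐ ℤ.* B ℤ.+ B ℤ.* G)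
    ≡⟨ step A B G Aᵐ Bᵐ (geometric-sum a b m) ⟩
  A ℤ.* (B ℤ.* Bᵐ) ℤ.- A ℤ.* Aᵐ ℤ.* B
    ≡⟨ cong₂ (λ u v → A ℤ.* u ℤ.- v ℤ.* B) (ℤP.pos-* b (b ^ suc m)) (ℤP.pos-* a (a ^ suc m)) ⟨
  A ℤ.* + (b ^ suc (suc m)) ℤ.- + (a ^ suc (suc m)) ℤ.* B
    ∎
  where
  A B Aᵐ Bᵐ G : ℤ
  A = + a
  B = + b
  Aᵐ = + (a ^ suc m)
  Bᵐ = + (b ^ suc m)
  G = ∑[ j ∈ upTo m ] (+ (a ^ (m ∸ j) * b ^ suc j))
  first : + (a ^ suc m * b ^ 1) ≡ Aᵐ ℤ.* B
  first = trans (ℤP.pos-* (a ^ suc m) (b ^ 1)) (cong (λ u → Aᵐ ℤ.* + u) (ℕP.^-identityʳ b))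
  rest : ∑[ j ∈ upTo m ] (+ (a ^ (m ∸ j) * b ^ suc (suc j))) ≡ B ℤ.* G
  rest = trans (∑-cong (upTo m) (λ j → trans (cong +_ (*-leftComm (a ^ (m ∸ j)) b (b ^ suc j))) (ℤP.pos-* b _)))
               (∑-*ˡ (upTo m) B _)
  step : ∀ A B G Aᵐ Bᵐ → (B ℤ.- A) ℤ.* G ≡ A ℤ.* Bᵐ ℤ.- Aᵐ ℤ.* B →
    (B ℤ.- A) ℤ.* (Aᵐ ℤ.* B ℤ.+ B ℤ.* G) ≡ A ℤ.* (B ℤ.* Bᵐ) ℤ.- A ℤ.* Aᵐ ℤ.* B
  step A B G Aᵐ Bᵐ hyp = begin
    (B ℤ.- A) ℤ.* (Aᵐ ℤ.* B ℤ.+ B ℤ.* G)               ≡⟨ solve (A ∷ B ∷ G ∷ Aᵐ ∷ []) ⟩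
    (B ℤ.- A) ℤ.* Aᵐ ℤ.* B ℤ.+ B ℤ.* ((B ℤ.- A) ℤ.* G) ≡⟨ cong (λ t → (B ℤ.- A) ℤ.* Aᵐ ℤ.* B ℤ.+ B ℤ.* t) hyp ⟩
    (B ℤ.- A) ℤ.* Aᵐ ℤ.* B ℤ.+ B ℤ.* (A ℤ.* Bᵐ ℤ.- Aᵐ ℤ.* B) ≡⟨ solve (A ∷ B ∷ Aᵐ ∷ Bᵐ ∷ []) ⟩
    A ℤ.* (B ℤ.* Bᵐ) ℤ.- A ℤ.* Aᵐ ℤ.* B                ∎

∑-tuples-suc : (a m : ℕ) (f : List ℕ → ℤ) →
  ∑ (tuples a (suc m)) f ≡ ∑[ x ∈ upTo a ] ∑[ xs ∈ tuples a m ] f (x ∷ xs)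
∑-tuples-suc a m f = trans (∑-concatMap (λ x → map (x ∷_) (tuples a m)) (upTo a) f)
                           (∑-cong (upTo a) (λ x → ∑-map (x ∷_) (tuples a m) f))

∑-tuples-∷ʳ : (a m : ℕ) (f : List ℕ → ℤ) →
  ∑ (tuples a (suc m)) f ≡ ∑[ xs ∈ tuples a m ] ∑[ y ∈ upTo a ] f (xs ∷ʳ y)
∑-tuples-∷ʳ a zero    f = begin
  ∑ (tuples a 1) f                           ≡⟨ ∑-tuples-suc a 0 f ⟩
  ∑[ y ∈ upTo a ] (f (y ∷ []) ℤ.+ + 0)       ≡⟨ ∑-cong (upTo a) (λ y → ℤP.+-identityʳ (f (y ∷ []))) ⟩
  ∑[ y ∈ upTo a ] f (y ∷ [])                 ≡⟨ ℤP.+-identityʳ _ ⟨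
  ∑[ y ∈ upTo a ] f (y ∷ []) ℤ.+ + 0         ∎
∑-tuples-∷ʳ a (suc m) f = begin
  ∑ (tuples a (suc (suc m))) f
    ≡⟨ ∑-tuples-suc a (suc m) f ⟩
  ∑[ x ∈ upTo a ] ∑[ zs ∈ tuples a (suc m) ] f (x ∷ zs)
    ≡⟨ ∑-cong (upTo a) (λ x → ∑-tuples-∷ʳ a m (f ∘ (x ∷_))) ⟩
  ∑[ x ∈ upTo a ] ∑[ xs ∈ tuples a m ] ∑[ y ∈ upTo a ] f (x ∷ xs ∷ʳ y)
    ≡⟨ ∑-tuples-suc a m (λ xs → ∑[ y ∈ upTo a ] f (xs ∷ʳ y)) ⟨
  ∑[ xs ∈ tuples a (suc m) ] ∑[ y ∈ upTo a ] f (xs ∷ʳ y) ∎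

∑-tuples-cong : (a m : ℕ) {f g : List ℕ → ℤ} → (∀ xs → length xs ≡ m → f xs ≡ g xs) →
  ∑ (tuples a m) f ≡ ∑ (tuples a m) g
∑-tuples-cong a zero    f≡g = cong (λ t → t ℤ.+ + 0) (f≡g [] refl)
∑-tuples-cong a (suc m) {f} {g} f≡g = begin
  ∑ (tuples a (suc m)) f
    ≡⟨ ∑-tuples-suc a m f ⟩
  ∑[ x ∈ upTo a ] ∑[ xs ∈ tuples a m ] f (x ∷ xs)
    ≡⟨ ∑-cong (upTo a) (λ x → ∑-tuples-cong a m (λ xs len → f≡g (x ∷ xs) (cong suc len))) ⟩
  ∑[ x ∈ upTo a ] ∑[ xs ∈ tuples a m ] g (x ∷ xs)
    ≡⟨ ∑-tuples-suc a m g ⟨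
  ∑ (tuples a (suc m)) g ∎

length-tuples : (a m : ℕ) → length (tuples a m) ≡ a ^ m
length-tuples a zero    = refl
length-tuples a (suc m) = trans (length-concatMap (upTo a)) (cong₂ _*_ (length-upTo a) (length-tuples a m))
  where
  length-concatMap : ∀ xs → length (concatMap (λ x → map (x ∷_) (tuples a m)) xs) ≡ length xs * length (tuples a m)
  length-concatMap []       = refl
  length-concatMap (x ∷ xs) = trans (length-++ (map (x ∷_) (tuples a m)))
                                    (cong₂ _+_ (length-map (x ∷_) (tuples a m)) (length-concatMap xs))

coprime-∣ˡ : ∀ {a b d} → Coprime a b → d ∣ a → Coprime d b
coprime-∣ˡ cop d∣a (i∣d , i∣b) = cop (∣-trans i∣d d∣a , i∣b)

coprime-^ʳ : ∀ {d b} → Coprime d b → ∀ e → Coprime d (b ^ e)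
coprime-^ʳ cop zero    (i∣d , i∣1)    = ∣1⇒≡1 i∣1
coprime-^ʳ cop (suc e) (i∣d , i∣b*bᵉ) = coprime-^ʳ cop e (i∣d , coprime-divisor (coprime-∣ˡ cop i∣d) i∣b*bᵉ)

𝟙[_∣_] : ℕ → ℕ → ℤ
𝟙[ d ∣ n ] = if does (d ∣? n) then + 1 else + 0

𝟙-yes : ∀ {d n} → d ∣ n → 𝟙[ d ∣ n ] ≡ + 1
𝟙-yes {d} {n} d∣n rewrite dec-true (d ∣? n) d∣n = refl

𝟙-no : ∀ {d n} → ¬ d ∣ n → 𝟙[ d ∣ n ] ≡ + 0
𝟙-no {d} {n} d∤n rewrite dec-false (d ∣? n) d∤n = refl

𝟙-cong : ∀ {d m n} → (d ∣ m → d ∣ n) → (d ∣ n → d ∣ m) → 𝟙[ d ∣ m ] ≡ 𝟙[ d ∣ n ]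
𝟙-cong {d} {m} m⇒n n⇒m with d ∣? m
... | yes d∣m = sym (𝟙-yes (m⇒n d∣m))
... | no  d∤m = sym (𝟙-no (d∤m ∘ n⇒m))

𝟙-+ˡ : ∀ {d c n} → d ∣ c → 𝟙[ d ∣ c + n ] ≡ 𝟙[ d ∣ n ]
𝟙-+ˡ d∣c = 𝟙-cong (λ d∣c+n → ∣m+n∣m⇒∣n d∣c+n d∣c) (∣m∣n⇒∣m+n d∣c)

𝟙-*-coprime : ∀ {d c n} → Coprime d c → 𝟙[ d ∣ n * c ] ≡ 𝟙[ d ∣ n ]
𝟙-*-coprime {d} {c} {n} cop =
  𝟙-cong (λ d∣nc → coprime-divisor cop (subst (d ∣_) (ℕP.*-comm n c) d∣nc)) (∣m⇒∣m*n c)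

coeffMod-zero : (d : ℕ) .{{_ : NonZero d}} (p : Poly) → coeffMod d 0 p ≡ ∑ p (uncurry λ c e → c ℤ.* 𝟙[ d ∣ e ])
coeffMod-zero d []            = refl
coeffMod-zero d ((c , e) ∷ p) with e % d ≟ 0
... | yes e%d≡0 = cong₂ ℤ._+_ (sym (trans (cong (c ℤ.*_) (𝟙-yes (m%n≡0⇒n∣m e d e%d≡0))) (ℤP.*-identityʳ c)))
                              (coeffMod-zero d p)
... | no  e%d≢0 = trans (sym (ℤP.+-identityˡ (coeffMod d 0 p)))
                        (cong₂ ℤ._+_ (sym (trans (cong (c ℤ.*_) (𝟙-no (e%d≢0 ∘ n∣m⇒m%n≡0 e d))) (ℤP.*-zeroʳ c)))
                                     (coeffMod-zero d p))

∑-𝟙-multiples : (d′ q : ℕ) (f : ℕ → ℤ) →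
  ∑[ y ∈ upTo (q * suc d′) ] (f y ℤ.* 𝟙[ suc d′ ∣ y ]) ≡ ∑[ j ∈ upTo q ] f (j * suc d′)
∑-𝟙-multiples d′ zero    f = refl
∑-𝟙-multiples d′ (suc q) f = begin
  ∑[ y ∈ upTo (d + q * d) ] (f y ℤ.* 𝟙[ d ∣ y ])
    ≡⟨ ∑-upTo-+ d (q * d) (λ y → f y ℤ.* 𝟙[ d ∣ y ]) ⟩
  ∑[ y ∈ upTo d ] (f y ℤ.* 𝟙[ d ∣ y ]) ℤ.+ ∑[ y ∈ upTo (q * d) ] (f (d + y) ℤ.* 𝟙[ d ∣ d + y ])
    ≡⟨ cong₂ ℤ._+_ one-period (∑-cong (upTo (q * d)) (λ y → cong (f (d + y) ℤ.*_) (𝟙-+ˡ (∣-refl {d})))) ⟩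
  f 0 ℤ.+ ∑[ y ∈ upTo (q * d) ] (f (d + y) ℤ.* 𝟙[ d ∣ y ])
    ≡⟨ cong (ℤ._+_ (f 0)) (∑-𝟙-multiples d′ q (λ y → f (d + y))) ⟩
  f 0 ℤ.+ ∑[ j ∈ upTo q ] f (d + j * d)
    ≡⟨ ∑-upTo-suc q (λ j → f (j * d)) ⟨
  ∑[ j ∈ upTo (suc q) ] f (j * d)
    ∎
  where
  d : ℕ
  d = suc d′
  one-period : ∑[ y ∈ upTo d ] (f y ℤ.* 𝟙[ d ∣ y ]) ≡ f 0
  one-period = begin
    ∑[ y ∈ upTo d ] (f y ℤ.* 𝟙[ d ∣ y ])
      ≡⟨ ∑-upTo-suc d′ (λ y → f y ℤ.* 𝟙[ d ∣ y ]) ⟩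
    f 0 ℤ.* 𝟙[ d ∣ 0 ] ℤ.+ ∑[ y ∈ upTo d′ ] (f (suc y) ℤ.* 𝟙[ d ∣ suc y ])
      ≡⟨ cong₂ ℤ._+_ (cong (f 0 ℤ.*_) (𝟙-yes (d ∣0))) (∑-upTo-cong d′ (λ y<d′ → cong (f _ ℤ.*_) (𝟙-no (d∤ y<d′)))) ⟩
    f 0 ℤ.* + 1 ℤ.+ ∑[ y ∈ upTo d′ ] (f (suc y) ℤ.* + 0)
      ≡⟨ cong₂ ℤ._+_ (ℤP.*-identityʳ (f 0)) (∑-cong (upTo d′) (λ y → ℤP.*-zeroʳ (f (suc y)))) ⟩
    f 0 ℤ.+ ∑[ _ ∈ upTo d′ ] (+ 0)
      ≡⟨ cong (ℤ._+_ (f 0)) (trans (∑-const (upTo d′) (+ 0)) (ℤP.*-zeroʳ (+ length (upTo d′)))) ⟩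
    f 0 ℤ.+ + 0
      ≡⟨ ℤP.+-identityʳ (f 0) ⟩
    f 0 ∎
    where
    d∤ : ∀ {y} → y < d′ → ¬ d ∣ suc y
    d∤ y<d′ d∣sy = ℕP.<⇒≱ (s≤s y<d′) (∣⇒≤ d∣sy)

∑-𝟙-progression : (d′ q w c : ℕ) → suc d′ ∣ w → Coprime (suc d′) c →
  ∑[ y ∈ upTo (q * suc d′) ] (+ (w + y * c) ℤ.* 𝟙[ suc d′ ∣ w + y * c ]) ≡ ∑[ j ∈ upTo q ] (+ (w + j * suc d′ * c))
∑-𝟙-progression d′ q w c d∣w cop =
  trans (∑-cong (upTo (q * suc d′)) (λ y → cong (+ (w + y * c) ℤ.*_) (trans (𝟙-+ˡ d∣w) (𝟙-*-coprime {n = y} cop))))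
        (∑-𝟙-multiples d′ q (λ y → + (w + y * c)))

∣a⇒∣a^[k∸i] : ∀ {d a i k} → d ∣ a → i < k → d ∣ a ^ (k ∸ i)
∣a⇒∣a^[k∸i] {a = a} {i = zero}  {k = suc k} d∣a _         = ∣m⇒∣m*n (a ^ k) d∣a
∣a⇒∣a^[k∸i]         {i = suc i} {k = suc k} d∣a (s≤s i<k) = ∣a⇒∣a^[k∸i] d∣a i<k

module _ (a b k : ℕ) where

  weighted-∷ʳ : (i : ℕ) (xs : List ℕ) (y : ℕ) →
    weighted a b k i (xs ∷ʳ y) ≡ weighted a b k i xs + y * g a b k (i + length xs)
  weighted-∷ʳ i []       y = trans (ℕP.+-identityʳ (y * g a b k i)) (cong (λ j → y * g a b k j) (sym (ℕP.+-identityʳ i)))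
  weighted-∷ʳ i (n ∷ xs) y = begin
    n * g a b k i + weighted a b k (suc i) (xs ∷ʳ y)
      ≡⟨ cong (_+_ (n * g a b k i)) (weighted-∷ʳ (suc i) xs y) ⟩
    n * g a b k i + (weighted a b k (suc i) xs + y * g a b k (suc i + length xs))
      ≡⟨ ℕP.+-assoc (n * g a b k i) _ _ ⟨
    n * g a b k i + weighted a b k (suc i) xs + y * g a b k (suc i + length xs)
      ≡⟨ cong (λ j → n * g a b k i + weighted a b k (suc i) xs + y * g a b k j) (ℕP.+-suc i (length xs)) ⟨
    n * g a b k i + weighted a b k (suc i) xs + y * g a b k (i + suc (length xs)) ∎

  g-last : g a b k k ≡ b ^ k
  g-last = trans (cong (λ e → a ^ e * b ^ k) (ℕP.n∸n≡0 k)) (ℕP.*-identityˡ (b ^ k))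

  weighted-divisible : ∀ {d} → d ∣ a → ∀ i xs → i + length xs ≤ k → d ∣ weighted a b k i xs
  weighted-divisible {d} d∣a i []       _  = d ∣0
  weighted-divisible {d} d∣a i (n ∷ xs) le =
    ∣m∣n⇒∣m+n (∣n⇒∣m*n n (∣m⇒∣m*n (b ^ i) (∣a⇒∣a^[k∸i] d∣a i<k)))
              (weighted-divisible d∣a (suc i) xs le′)
    where
    le′ : suc i + length xs ≤ k
    le′ = subst (_≤ k) (ℕP.+-suc i (length xs)) le
    i<k : i < k
    i<k = ℕP.≤-trans (ℕP.m≤m+n (suc i) (length xs)) le′

  ∑-weighted : (i m : ℕ) →
    + 2 ℤ.* ∑[ xs ∈ tuples a m ] (+ weighted a b k i xs)
      ≡ + (a ^ m) ℤ.* (+ a ℤ.- + 1) ℤ.* ∑[ j ∈ upTo m ] (+ g a b k (i + j))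
  ∑-weighted i zero    = sym (ℤP.*-zeroʳ (+ 1 ℤ.* (+ a ℤ.- + 1)))
  ∑-weighted i (suc m) = begin
    + 2 ℤ.* ∑[ zs ∈ tuples a (suc m) ] (+ weighted a b k i zs)
      ≡⟨ cong (+ 2 ℤ.*_) (trans (∑-tuples-suc a m _) (∑-cong (upTo a) (λ x → ∑-cong (tuples a m) (split x)))) ⟩
    + 2 ℤ.* ∑[ x ∈ upTo a ] ∑[ xs ∈ tuples a m ] (+ x ℤ.* G ℤ.+ + weighted a b k (suc i) xs)
      ≡⟨ cong (+ 2 ℤ.*_) (∑-separable (upTo a) (tuples a m) (λ x → + x ℤ.* G) _) ⟩
    + 2 ℤ.* (+ length (tuples a m) ℤ.* ∑[ x ∈ upTo a ] (+ x ℤ.* G) ℤ.+ + length (upTo a) ℤ.* S)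
      ≡⟨ cong₂ (λ n p → + 2 ℤ.* (+ n ℤ.* p ℤ.+ + length (upTo a) ℤ.* S)) (length-tuples a m) (∑-*ʳ (upTo a) (λ x → + x) G) ⟩
    + 2 ℤ.* (+ (a ^ m) ℤ.* (X ℤ.* G) ℤ.+ + length (upTo a) ℤ.* S)
      ≡⟨ cong (λ n → + 2 ℤ.* (+ (a ^ m) ℤ.* (X ℤ.* G) ℤ.+ + n ℤ.* S)) (length-upTo a) ⟩
    + 2 ℤ.* (+ (a ^ m) ℤ.* (X ℤ.* G) ℤ.+ + a ℤ.* S)
      ≡⟨ step (+ (a ^ m)) (+ a) X G S T (gauss a) (∑-weighted (suc i) m) ⟩
    + a ℤ.* + (a ^ m) ℤ.* (+ a ℤ.- + 1) ℤ.* (G ℤ.+ T)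
      ≡⟨ cong₂ (λ p t → p ℤ.* (+ a ℤ.- + 1) ℤ.* t) (ℤP.pos-* a (a ^ m)) first-term ⟨
    + (a ^ suc m) ℤ.* (+ a ℤ.- + 1) ℤ.* ∑[ j ∈ upTo (suc m) ] (+ g a b k (i + j))
      ∎
    where
    G S X T : ℤ
    G = + g a b k i
    S = ∑[ xs ∈ tuples a m ] (+ weighted a b k (suc i) xs)
    X = ∑[ x ∈ upTo a ] (+ x)
    T = ∑[ j ∈ upTo m ] (+ g a b k (suc i + j))
    split : ∀ x xs → + (x * g a b k i + weighted a b k (suc i) xs) ≡ + x ℤ.* G ℤ.+ + weighted a b k (suc i) xs
    split x xs = trans (ℤP.pos-+ (x * g a b k i) _) (cong (ℤ._+ _) (ℤP.pos-* x (g a b k i)))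
    first-term : ∑[ j ∈ upTo (suc m) ] (+ g a b k (i + j)) ≡ G ℤ.+ T
    first-term = trans (∑-upTo-suc m (λ j → + g a b k (i + j)))
                       (cong₂ ℤ._+_ (cong (λ j → + g a b k j) (ℕP.+-identityʳ i))
                                    (∑-cong (upTo m) (λ j → cong (λ l → + g a b k l) (ℕP.+-suc i j))))
    step : ∀ P A X G S T → + 2 ℤ.* X ≡ A ℤ.* (A ℤ.- + 1) → + 2 ℤ.* S ≡ P ℤ.* (A ℤ.- + 1) ℤ.* T →
      + 2 ℤ.* (P ℤ.* (X ℤ.* G) ℤ.+ A ℤ.* S) ≡ A ℤ.* P ℤ.* (A ℤ.- + 1) ℤ.* (G ℤ.+ T)
    step P A X G S T 2X≡ 2S≡ = begin
      + 2 ℤ.* (P ℤ.* (X ℤ.* G) ℤ.+ A ℤ.* S)                   ≡⟨ solve (P ∷ A ∷ X ∷ G ∷ S ∷ []) ⟩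
      P ℤ.* G ℤ.* (+ 2 ℤ.* X) ℤ.+ A ℤ.* (+ 2 ℤ.* S)           ≡⟨ cong₂ (λ u v → P ℤ.* G ℤ.* u ℤ.+ A ℤ.* v) 2X≡ 2S≡ ⟩
      P ℤ.* G ℤ.* (A ℤ.* (A ℤ.- + 1)) ℤ.+ A ℤ.* (P ℤ.* (A ℤ.- + 1) ℤ.* T) ≡⟨ solve (P ∷ A ∷ G ∷ T ∷ []) ⟩
      A ℤ.* P ℤ.* (A ℤ.- + 1) ℤ.* (G ℤ.+ T)                   ∎

module _ (a b m d′ q : ℕ) (a≡qd : a ≡ q * suc d′) (cop : Coprime (suc d′) b) where

  private
    d k : ℕ
    d = suc d′
    k = suc m

    W : List ℕ → ℕ
    W = weighted a b k 1

    δ : ℕ → ℤ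
    δ e = + e ℤ.* 𝟙[ d ∣ e ]

  ∑-last-coordinate : ∀ xs → length xs ≡ m →
    ∑[ y ∈ upTo a ] δ (W (xs ∷ʳ y)) ≡ ∑[ j ∈ upTo q ] (+ W xs ℤ.+ + j ℤ.* + (d * b ^ k))
  ∑-last-coordinate xs len = begin
    ∑[ y ∈ upTo a ] δ (W (xs ∷ʳ y))             ≡⟨ ∑-cong (upTo a) (λ y → cong δ (W-∷ʳ y)) ⟩
    ∑[ y ∈ upTo a ] δ (W xs + y * b ^ k)         ≡⟨ cong (λ n → ∑[ y ∈ upTo n ] δ (W xs + y * b ^ k)) a≡qd ⟩
    ∑[ y ∈ upTo (q * d) ] δ (W xs + y * b ^ k)   ≡⟨ ∑-𝟙-progression d′ q (W xs) (b ^ k) d∣W (coprime-^ʳ cop k) ⟩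
    ∑[ j ∈ upTo q ] (+ (W xs + j * d * b ^ k))   ≡⟨ ∑-cong (upTo q) split ⟩
    ∑[ j ∈ upTo q ] (+ W xs ℤ.+ + j ℤ.* + (d * b ^ k)) ∎
    where
    W-∷ʳ : ∀ y → W (xs ∷ʳ y) ≡ W xs + y * b ^ k
    W-∷ʳ y = begin
      W (xs ∷ʳ y)                         ≡⟨ weighted-∷ʳ a b k 1 xs y ⟩
      W xs + y * g a b k (1 + length xs)  ≡⟨ cong (λ l → W xs + y * g a b k (suc l)) len ⟩
      W xs + y * g a b k k                ≡⟨ cong (λ t → W xs + y * t) (g-last a b k) ⟩
      W xs + y * b ^ k                    ∎
    d∣W : d ∣ W xs
    d∣W = weighted-divisible a b k (divides q a≡qd) 1 xs (ℕP.≤-reflexive (cong suc len))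
    split : ∀ j → + (W xs + j * d * b ^ k) ≡ + W xs ℤ.+ + j ℤ.* + (d * b ^ k)
    split j = trans (ℤP.pos-+ (W xs) _) (cong (ℤ._+_ (+ W xs)) (trans (cong +_ (ℕP.*-assoc j d (b ^ k))) (ℤP.pos-* j _)))

  coeffMod-f₁ : coeffMod d 0 (f₁ a b k)
    ≡ + q ℤ.* ∑[ xs ∈ tuples a m ] (+ W xs) ℤ.+ + (a ^ m) ℤ.* (∑[ j ∈ upTo q ] (+ j) ℤ.* (+ d ℤ.* + (b ^ k)))
  coeffMod-f₁ = begin
    coeffMod d 0 (f₁ a b k)
      ≡⟨ trans (coeffMod-zero d (f₁ a b k)) (∑-map _ (tuples a k) _) ⟩
    ∑[ zs ∈ tuples a k ] δ (W zs)
      ≡⟨ ∑-tuples-∷ʳ a m (δ ∘ W) ⟩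
    ∑[ xs ∈ tuples a m ] ∑[ y ∈ upTo a ] δ (W (xs ∷ʳ y))
      ≡⟨ ∑-tuples-cong a m ∑-last-coordinate ⟩
    ∑[ xs ∈ tuples a m ] ∑[ j ∈ upTo q ] (+ W xs ℤ.+ + j ℤ.* + (d * b ^ k))
      ≡⟨ ∑-separable (tuples a m) (upTo q) (λ xs → + W xs) (λ j → + j ℤ.* + (d * b ^ k)) ⟩
    + length (upTo q) ℤ.* ∑[ xs ∈ tuples a m ] (+ W xs) ℤ.+ + length (tuples a m) ℤ.* ∑[ j ∈ upTo q ] (+ j ℤ.* + (d * b ^ k))
      ≡⟨ cong₂ (λ u v → + u ℤ.* ∑[ xs ∈ tuples a m ] (+ W xs) ℤ.+ + v ℤ.* ∑[ j ∈ upTo q ] (+ j ℤ.* + (d * b ^ k)))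
               (length-upTo q) (length-tuples a m) ⟩
    + q ℤ.* ∑[ xs ∈ tuples a m ] (+ W xs) ℤ.+ + (a ^ m) ℤ.* ∑[ j ∈ upTo q ] (+ j ℤ.* + (d * b ^ k))
      ≡⟨ cong (λ t → + q ℤ.* ∑[ xs ∈ tuples a m ] (+ W xs) ℤ.+ + (a ^ m) ℤ.* t)
              (trans (∑-*ʳ (upTo q) (λ j → + j) _) (cong (ℤ._*_ (∑[ j ∈ upTo q ] (+ j))) (ℤP.pos-* d (b ^ k)))) ⟩
    + q ℤ.* ∑[ xs ∈ tuples a m ] (+ W xs) ℤ.+ + (a ^ m) ℤ.* (∑[ j ∈ upTo q ] (+ j) ℤ.* (+ d ℤ.* + (b ^ k)))
      ∎

c₁₀-closed-form : ∀ (A B D Q P Aᵏ Bᵏ S G J : ℤ) → A ≡ Q ℤ.* D → Aᵏ ≡ A ℤ.* P →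
  + 2 ℤ.* S ≡ P ℤ.* (A ℤ.- + 1) ℤ.* G → (B ℤ.- A) ℤ.* G ≡ A ℤ.* Bᵏ ℤ.- Aᵏ ℤ.* B → + 2 ℤ.* J ≡ Q ℤ.* (Q ℤ.- + 1) →
  (Q ℤ.* S ℤ.+ P ℤ.* (J ℤ.* (D ℤ.* Bᵏ))) ℤ.* (+ 2 ℤ.* (B ℤ.- A) ℤ.* D)
    ≡ Aᵏ ℤ.* (Bᵏ ℤ.* (A ℤ.* B ℤ.- A ℤ.+ A ℤ.* D ℤ.- B ℤ.* D) ℤ.- Aᵏ ℤ.* (A ℤ.- + 1) ℤ.* B)
c₁₀-closed-form A B D Q P _ Bᵏ S G J A≡QD refl 2S≡ geo 2J≡ = begin
  (Q ℤ.* S ℤ.+ P ℤ.* (J ℤ.* (D ℤ.* Bᵏ))) ℤ.* (+ 2 ℤ.* (B ℤ.- A) ℤ.* D)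
    ≡⟨ solve (A ∷ B ∷ D ∷ Q ∷ P ∷ Bᵏ ∷ S ∷ J ∷ []) ⟩
  Q ℤ.* D ℤ.* (B ℤ.- A) ℤ.* (+ 2 ℤ.* S) ℤ.+ P ℤ.* Bᵏ ℤ.* (B ℤ.- A) ℤ.* D ℤ.* D ℤ.* (+ 2 ℤ.* J)
    ≡⟨ cong₂ (λ u v → Q ℤ.* D ℤ.* (B ℤ.- A) ℤ.* u ℤ.+ P ℤ.* Bᵏ ℤ.* (B ℤ.- A) ℤ.* D ℤ.* D ℤ.* v) 2S≡ 2J≡ ⟩
  Q ℤ.* D ℤ.* (B ℤ.- A) ℤ.* (P ℤ.* (A ℤ.- + 1) ℤ.* G) ℤ.+ P ℤ.* Bᵏ ℤ.* (B ℤ.- A) ℤ.* D ℤ.* D ℤ.* (Q ℤ.* (Q ℤ.- + 1))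
    ≡⟨ solve (A ∷ B ∷ D ∷ Q ∷ P ∷ Bᵏ ∷ G ∷ []) ⟩
  Q ℤ.* D ℤ.* P ℤ.* (A ℤ.- + 1) ℤ.* ((B ℤ.- A) ℤ.* G) ℤ.+ P ℤ.* Bᵏ ℤ.* (B ℤ.- A) ℤ.* (Q ℤ.* D) ℤ.* (Q ℤ.* D ℤ.- D)
    ≡⟨ cong (λ u → u ℤ.* P ℤ.* (A ℤ.- + 1) ℤ.* ((B ℤ.- A) ℤ.* G) ℤ.+ P ℤ.* Bᵏ ℤ.* (B ℤ.- A) ℤ.* u ℤ.* (u ℤ.- D)) A≡QD ⟨
  A ℤ.* P ℤ.* (A ℤ.- + 1) ℤ.* ((B ℤ.- A) ℤ.* G) ℤ.+ P ℤ.* Bᵏ ℤ.* (B ℤ.- A) ℤ.* A ℤ.* (A ℤ.- D)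
    ≡⟨ cong (λ t → A ℤ.* P ℤ.* (A ℤ.- + 1) ℤ.* t ℤ.+ P ℤ.* Bᵏ ℤ.* (B ℤ.- A) ℤ.* A ℤ.* (A ℤ.- D)) geo ⟩
  A ℤ.* P ℤ.* (A ℤ.- + 1) ℤ.* (A ℤ.* Bᵏ ℤ.- A ℤ.* P ℤ.* B) ℤ.+ P ℤ.* Bᵏ ℤ.* (B ℤ.- A) ℤ.* A ℤ.* (A ℤ.- D)
    ≡⟨ solve (A ∷ B ∷ D ∷ P ∷ Bᵏ ∷ []) ⟩
  A ℤ.* P ℤ.* (Bᵏ ℤ.* (A ℤ.* B ℤ.- A ℤ.+ A ℤ.* D ℤ.- B ℤ.* D) ℤ.- A ℤ.* P ℤ.* (A ℤ.- + 1) ℤ.* B)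
    ∎

mainTheorem15 : (a b k d : ℕ) → 1 < a → 1 < b → 1 ≤ k → gcd a b ≡ 1 → d ∣ a → .{{_ : NonZero d}} →
  coeffMod d 0 (f₁ a b k) ℤ.* (+ 2 ℤ.* (+ b ℤ.- + a) ℤ.* + d)
    ≡ + (a ^ k) ℤ.* (+ (b ^ k) ℤ.* (+ a ℤ.* + b ℤ.- + a ℤ.+ + a ℤ.* + d ℤ.- + b ℤ.* + d) ℤ.- + (a ^ k) ℤ.* (+ a ℤ.- + 1) ℤ.* + b)
mainTheorem15 a b zero    d        _ _ () _ _
mainTheorem15 a b (suc m) zero     _ _ _  _ _ = contradiction refl (≢-nonZero⁻¹ 0)
mainTheorem15 a b (suc m) (suc d′) _ _ _ gcd≡1 d∣a@(divides q a≡qd) =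
  trans (cong (ℤ._* (+ 2 ℤ.* (+ b ℤ.- + a) ℤ.* + suc d′)) (coeffMod-f₁ a b m d′ q a≡qd d⊥b))
        (c₁₀-closed-form (+ a) (+ b) (+ suc d′) (+ q) (+ (a ^ m)) (+ (a ^ suc m)) (+ (b ^ suc m)) _ _ _
          (trans (cong +_ a≡qd) (ℤP.pos-* q (suc d′))) (ℤP.pos-* a (a ^ m))
          (∑-weighted a b (suc m) 1 m) (geometric-sum a b m) (gauss q))
  where
  d⊥b : Coprime (suc d′) b
  d⊥b = coprime-∣ˡ (gcd≡1⇒coprime gcd≡1) d∣a
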